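{- Let $H$ be a $d$-degenerate graph with $n$ vertices and chromatic number $q$. If $G$ is a graph with disjoint vertex subsets $Y_1,\ldots,Y_q$ with $|Y_1|=\cdots=|Y_q|\geq 4n$ such that each vertex of $Y_i$ is adjacent to all but at most $\frac{|Y_i|}{2d}$ vertices of $\bigcup_{j\neq i}Y_j$, then $H$ is a subgraph of $G$.
   Context: A graph is $d$-degenerate if every subgraph has a vertex of degree at most $d$. -}

module Defs where

open import Data.Nat using (ℕ; _*_; _≤_; _<_)
open import Data.Bool using (Bool; true; false)
open import Data.Fin using (Fin; _≟_)
open import Data.Fin.Subset using (Subset; _∈_; _∩_; ∁; ⋃; ∣_∣; Nonempty; Empty)
open import Data.Vec using (tabulate)
open import Data.List using (List; map; filter)
open import Data.List.Base using (allFin)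
open import Data.Product using (Σ; ∃; _×_; _,_)
open import Relation.Nullary using (¬_)
open import Relation.Nullary.Decidable using (¬?)
open import Relation.Binary.PropositionalEquality using (_≡_; _≢_)
open import Function.Definitions using (Injective)

record Graph : Set where
  field
    size  : ℕ
    adj   : Fin size → Fin size → Bool
    sym   : ∀ u v → adj u v ≡ adj v u
    irrefl : ∀ v → adj v v ≡ false
open Graph public

N[_] : (G : Graph) → Fin (size G) → Subset (size G)
N[ G ] v = tabulate (adj G v)

degIn : (G : Graph) → Subset (size G) → Fin (size G) → ℕ
degIn G S v = ∣ S ∩ N[ G ] v ∣

-- d-degenerate: every (nonempty) subgraph has a vertex of degree ≤ d.
-- (It suffices to consider induced subgraphs: deleting edges only lowers degrees.)
Degenerate : ℕ → Graph → Set
Degenerate d G = ∀ (S : Subset (size G)) → Nonempty S →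
  ∃ λ v → v ∈ S × degIn G S v ≤ d

ProperColouring : (G : Graph) → (k : ℕ) → (Fin (size G) → Fin k) → Set
ProperColouring G k c = ∀ u v → adj G u v ≡ true → c u ≢ c v

Colourable : Graph → ℕ → Set
Colourable G k = Σ (Fin (size G) → Fin k) (ProperColouring G k)

ChromaticNumber : Graph → ℕ → Set
ChromaticNumber G q = Colourable G q × (∀ k → k < q → ¬ Colourable G k)

IsSubgraph : Graph → Graph → Set
IsSubgraph H G = Σ (Fin (size H) → Fin (size G)) λ f →
  Injective _≡_ _≡_ f × (∀ u v → adj H u v ≡ true → adj G (f u) (f v) ≡ true)

OtherParts : ∀ {m q} → (Fin q → Subset m) → Fin q → Subset m
OtherParts {q = q} Y i = ⋃ (map Y (filter (λ j → ¬? (j ≟ i)) (allFin q)))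

nonNbrsOutside : (G : Graph) {q : ℕ} → (Fin q → Subset (size G)) → Fin q → Fin (size G) → ℕ
nonNbrsOutside G Y i v = ∣ OtherParts Y i ∩ ∁ (N[ G ] v) ∣

-- Embed H greedily, colour class i into Y i, in the reverse of a degeneracy ordering:
-- remove a vertex v of degree at most d, embed the rest, then place v.  At that moment v has
-- at most d embedded neighbours u, all of colours other than that of v, so each has at most
-- |Y|/2d non-neighbours in Y (c v).  Together with the fewer than n ≤ |Y|/4 used vertices,
-- fewer than |Y|/2 + |Y|/4 vertices of Y (c v) are excluded, which leaves room for v.
module Submission where

open import Defs
open import Data.Nat using (ℕ; zero; suc; _*_; _≤_; _+_; _<_; z≤n; s≤s)
open import Data.Nat.Properties hiding (_≟_)
open import Data.Nat.Tactic.RingSolver using (solve-∀)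
open import Data.Bool using (true; false)
open import Data.Empty using (⊥-elim)
open import Data.Fin using (Fin; zero; suc; _≟_; inject≤)
open import Data.Fin.Subset
open import Data.Fin.Subset.Properties
open import Data.Vec.Base using ([]; _∷_; here; there)
open import Data.Vec.Properties using ([]=⇒lookup; lookup⇒[]=; lookup∘tabulate)
open import Data.Vec.Functional using (updateAt)
open import Data.Vec.Functional.Properties using (updateAt-updates; updateAt-minimal)
open import Data.List.Base using (List; map; filter; allFin)
import Data.List.Base as List
open import Data.List.Membership.Propositional using () renaming (_∈_ to _∈ₗ_)
open import Data.List.Membership.Propositional.Properties using (∈-map⁺; ∈-filter⁺; ∈-allFin)
import Data.List.Relation.Unary.Any as Any
open import Data.Product using (∃; _×_; _,_)
open import Data.Sum using (_⊎_; inj₁; inj₂)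
open import Function using (_∘_; const)
open import Relation.Nullary using (yes; no)
open import Relation.Nullary.Decidable using (¬?)
import Relation.Binary.PropositionalEquality as ≡
open ≡ using (_≡_; _≢_; refl; trans; subst; subst₂)

private
  variable
    n N : ℕ

4[1+s]≤m∧t*2≤m⇒s+t<m : ∀ {s t m} → 4 * suc s ≤ m → t * 2 ≤ m → s + t < m
4[1+s]≤m∧t*2≤m⇒s+t<m {s} {t} {m} 4[1+s]≤m t*2≤m = *-cancelˡ-≤ 4 (begin
  4 * suc (s + t)            ≡⟨ expand s t ⟩
  4 * suc s + t * 2 * 2      ≤⟨ +-mono-≤ 4[1+s]≤m (*-monoˡ-≤ 2 t*2≤m) ⟩
  m + m * 2                  ≤⟨ m≤m+n (m + m * 2) m ⟩
  m + m * 2 + m              ≡⟨ collect m ⟩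
  4 * m                      ∎)
  where
  open ≤-Reasoning
  expand : ∀ s t → 4 * suc (s + t) ≡ 4 * suc s + t * 2 * 2
  expand = solve-∀
  collect : ∀ m → m + m * 2 + m ≡ 4 * m
  collect = solve-∀

∣p∪q∣≤∣p∣+∣q∣ : (p q : Subset n) → ∣ p ∪ q ∣ ≤ ∣ p ∣ + ∣ q ∣
∣p∪q∣≤∣p∣+∣q∣ []          []          = z≤n
∣p∪q∣≤∣p∣+∣q∣ (true ∷ p)  (true ∷ q)  = s≤s (≤-trans (∣p∪q∣≤∣p∣+∣q∣ p q) (+-monoʳ-≤ ∣ p ∣ (n≤1+n _)))
∣p∪q∣≤∣p∣+∣q∣ (true ∷ p)  (false ∷ q) = s≤s (∣p∪q∣≤∣p∣+∣q∣ p q)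
∣p∪q∣≤∣p∣+∣q∣ (false ∷ p) (true ∷ q)  = ≤-trans (s≤s (∣p∪q∣≤∣p∣+∣q∣ p q)) (≤-reflexive (≡.sym (+-suc _ _)))
∣p∪q∣≤∣p∣+∣q∣ (false ∷ p) (false ∷ q) = ∣p∪q∣≤∣p∣+∣q∣ p q

∩-monoˡ-⊆ : {p q : Subset n} (r : Subset n) → p ⊆ q → p ∩ r ⊆ q ∩ r
∩-monoˡ-⊆ {p = p} r p⊆q x∈p∩r with x∈p∩q⁻ p r x∈p∩r
... | x∈p , x∈r = x∈p∩q⁺ (p⊆q x∈p , x∈r)

∣q∣<∣p∣⇒∃∈p∖q : (p q : Subset n) → ∣ q ∣ < ∣ p ∣ → ∃ λ x → x ∈ p × x ∉ q
∣q∣<∣p∣⇒∃∈p∖q (true ∷ p)  (false ∷ q) _ = zero , here , λ ()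
∣q∣<∣p∣⇒∃∈p∖q (true ∷ p)  (true ∷ q)  (s≤s lt) with ∣q∣<∣p∣⇒∃∈p∖q p q lt
... | x , x∈p , x∉q = suc x , there x∈p , λ { (there x∈q) → x∉q x∈q }
∣q∣<∣p∣⇒∃∈p∖q (false ∷ p) (true ∷ q)  lt with ∣q∣<∣p∣⇒∃∈p∖q p q (≤-trans (n≤1+n _) lt)
... | x , x∈p , x∉q = suc x , there x∈p , λ { (there x∈q) → x∉q x∈q }
∣q∣<∣p∣⇒∃∈p∖q (false ∷ p) (false ∷ q) lt with ∣q∣<∣p∣⇒∃∈p∖q p q lt
... | x , x∈p , x∉q = suc x , there x∈p , λ { (there x∈q) → x∉q x∈q }

∑[_]_ : Subset n → (Fin n → ℕ) → ℕ
∑[ [] ]        w = 0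
∑[ true ∷ p ]  w = w zero + ∑[ p ] (w ∘ suc)
∑[ false ∷ p ] w = ∑[ p ] (w ∘ suc)

∑-≤ : (p : Subset n) {w : Fin n → ℕ} {B : ℕ} → (∀ {u} → u ∈ p → w u ≤ B) → ∑[ p ] w ≤ ∣ p ∣ * B
∑-≤ []          w≤B = z≤n
∑-≤ (true ∷ p)  w≤B = +-mono-≤ (w≤B here) (∑-≤ p (w≤B ∘ there))
∑-≤ (false ∷ p) w≤B = ∑-≤ p (w≤B ∘ there)

∑-*ʳ : (p : Subset n) (w : Fin n → ℕ) (k : ℕ) → ∑[ p ] (λ u → w u * k) ≡ ∑[ p ] w * k
∑-*ʳ []          w k = refl
∑-*ʳ (true ∷ p)  w k = trans (≡.cong (w zero * k +_) (∑-*ʳ p (w ∘ suc) k)) (≡.sym (*-distribʳ-+ k (w zero) _))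
∑-*ʳ (false ∷ p) w k = ∑-*ʳ p (w ∘ suc) k

∑-average : (p : Subset n) {w : Fin n → ℕ} {k m : ℕ} →
            ∣ p ∣ ≤ k → (∀ {u} → u ∈ p → w u * k ≤ m) → ∑[ p ] w ≤ m
∑-average p {w} {zero} ∣p∣≤0 _ = ≤-trans (∑-≤ p absurd) (≤-trans (≤-reflexive (*-zeroʳ ∣ p ∣)) z≤n)
  where
  absurd : ∀ {u} → u ∈ p → w u ≤ 0
  absurd u∈p with () ← ≤-trans (x∈p⇒∣p-x∣<∣p∣ u∈p) ∣p∣≤0
∑-average p {w} {k@(suc _)} {m} ∣p∣≤k wk≤m = *-cancelʳ-≤ _ m k (begin
  ∑[ p ] w * k              ≡⟨ ∑-*ʳ p w k ⟨
  ∑[ p ] (λ u → w u * k)    ≤⟨ ∑-≤ p wk≤m ⟩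
  ∣ p ∣ * m                 ≤⟨ *-monoˡ-≤ m ∣p∣≤k ⟩
  k * m                     ≡⟨ *-comm k m ⟩
  m * k                     ∎)
  where open ≤-Reasoning

⋃[_]_ : Subset n → (Fin n → Subset N) → Subset N
⋃[ [] ]        g = ⊥
⋃[ true ∷ p ]  g = g zero ∪ ⋃[ p ] (g ∘ suc)
⋃[ false ∷ p ] g = ⋃[ p ] (g ∘ suc)

∣⋃[]∣≤∑ : (p : Subset n) (g : Fin n → Subset N) → ∣ ⋃[ p ] g ∣ ≤ ∑[ p ] (∣_∣ ∘ g)
∣⋃[]∣≤∑ {N = N} [] g = ≤-reflexive (∣⊥∣≡0 N)
∣⋃[]∣≤∑ (true ∷ p)  g = ≤-trans (∣p∪q∣≤∣p∣+∣q∣ (g zero) _) (+-monoʳ-≤ _ (∣⋃[]∣≤∑ p (g ∘ suc)))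
∣⋃[]∣≤∑ (false ∷ p) g = ∣⋃[]∣≤∑ p (g ∘ suc)

⊆⋃[] : (p : Subset n) (g : Fin n → Subset N) {u : Fin n} → u ∈ p → g u ⊆ ⋃[ p ] g
⊆⋃[] (true ∷ p)  g here        = p⊆p∪q _
⊆⋃[] (true ∷ p)  g (there u∈p) = q⊆p∪q (g zero) _ ∘ ⊆⋃[] p (g ∘ suc) u∈p
⊆⋃[] (false ∷ p) g (there u∈p) = ⊆⋃[] p (g ∘ suc) u∈p

∣image∣≤∣p∣ : (p : Subset n) (f : Fin n → Fin N) → ∣ ⋃[ p ] (⁅_⁆ ∘ f) ∣ ≤ ∣ p ∣
∣image∣≤∣p∣ p f = begin
  ∣ ⋃[ p ] (⁅_⁆ ∘ f) ∣         ≤⟨ ∣⋃[]∣≤∑ p (⁅_⁆ ∘ f) ⟩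
  ∑[ p ] (λ u → ∣ ⁅ f u ⁆ ∣)   ≤⟨ ∑-≤ p (λ {u} _ → ≤-reflexive (∣⁅x⁆∣≡1 (f u))) ⟩
  ∣ p ∣ * 1                    ≡⟨ *-identityʳ ∣ p ∣ ⟩
  ∣ p ∣                        ∎
  where open ≤-Reasoning

∈image : (p : Subset n) (f : Fin n → Fin N) {u : Fin n} → u ∈ p → f u ∈ ⋃[ p ] (⁅_⁆ ∘ f)
∈image p f {u} u∈p = ⊆⋃[] p (⁅_⁆ ∘ f) u∈p (x∈⁅x⁆ (f u))

⊆⋃ : (ps : List (Subset n)) {p : Subset n} → p ∈ₗ ps → p ⊆ ⋃ ps
⊆⋃ (p List.∷ ps) (Any.here refl)  = p⊆p∪q _
⊆⋃ (q List.∷ ps) (Any.there p∈ps) = q⊆p∪q q _ ∘ ⊆⋃ ps p∈ps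

Y⊆OtherParts : {q : ℕ} (Y : Fin q → Subset n) {i j : Fin q} → j ≢ i → Y j ⊆ OtherParts Y i
Y⊆OtherParts {q = q} Y {i} {j} j≢i =
  ⊆⋃ (map Y (filter (λ k → ¬? (k ≟ i)) (allFin q)))
     (∈-map⁺ Y (∈-filter⁺ (λ k → ¬? (k ≟ i)) (∈-allFin j) j≢i))

∈N[]⁻ : (G : Graph) {v x : Fin (size G)} → x ∈ N[ G ] v → adj G v x ≡ true
∈N[]⁻ G {v} {x} x∈N = trans (≡.sym (lookup∘tabulate (adj G v) x)) ([]=⇒lookup x∈N)

∈N[]⁺ : (G : Graph) {v x : Fin (size G)} → adj G v x ≡ true → x ∈ N[ G ] v
∈N[]⁺ G {v} {x} vx = lookup⇒[]= x _ (trans (lookup∘tabulate (adj G v) x) vx)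

module Embedding (H G : Graph) {q : ℕ} (c : Fin (size H) → Fin q) (Y : Fin q → Subset (size G)) where

  record EmbeddingOn (S : Subset (size H)) (f : Fin (size H) → Fin (size G)) : Set where
    field
      respects-parts  : ∀ {u} → u ∈ S → f u ∈ Y (c u)
      injective-on    : ∀ {u w} → u ∈ S → w ∈ S → f u ≡ f w → u ≡ w
      preserves-edges : ∀ {u w} → u ∈ S → w ∈ S → adj H u w ≡ true → adj G (f u) (f w) ≡ true

  embeddingOn-empty : ∀ {S} → Empty S → (f : Fin (size H) → Fin (size G)) → EmbeddingOn S f
  embeddingOn-empty empty f = record
    { respects-parts  = λ u∈S → ⊥-elim (empty (_ , u∈S))
    ; injective-on    = λ u∈S _ _ → ⊥-elim (empty (_ , u∈S))
    ; preserves-edges = λ u∈S _ _ → ⊥-elim (empty (_ , u∈S))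
    }

  extend : ∀ {S v f x} → EmbeddingOn (S - v) f → x ∈ Y (c v) →
           (∀ {u} → u ∈ S - v → f u ≢ x) →
           (∀ {u} → u ∈ S - v → adj H v u ≡ true → adj G (f u) x ≡ true) →
           EmbeddingOn S (updateAt f v (const x))
  extend {S} {v} {f} {x} emb x∈Y fresh adjacent = record
    { respects-parts  = respects
    ; injective-on    = injective
    ; preserves-edges = preserves
    }
    where
    open EmbeddingOn emb
    g = updateAt f v (const x)

    new-or-old : ∀ {u} → u ∈ S → (u ≡ v × g u ≡ x) ⊎ (u ∈ S - v × g u ≡ f u)
    new-or-old {u} u∈S with u ≟ v
    ... | yes refl = inj₁ (refl , updateAt-updates v f)
    ... | no u≢v   = inj₂ (x∈p∧x≢y⇒x∈p-y u∈S u≢v , updateAt-minimal u v f u≢v)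

    respects : ∀ {u} → u ∈ S → g u ∈ Y (c u)
    respects u∈S with new-or-old u∈S
    ... | inj₁ (refl , gu≡x)  = subst (_∈ Y (c v)) (≡.sym gu≡x) x∈Y
    ... | inj₂ (u∈S' , gu≡fu) = subst (_∈ Y (c _)) (≡.sym gu≡fu) (respects-parts u∈S')

    injective : ∀ {u w} → u ∈ S → w ∈ S → g u ≡ g w → u ≡ w
    injective u∈S w∈S gu≡gw with new-or-old u∈S | new-or-old w∈S
    ... | inj₁ (refl , _)     | inj₁ (refl , _)     = refl
    ... | inj₁ (refl , gv≡x)  | inj₂ (w∈S' , gw≡fw) =
      ⊥-elim (fresh w∈S' (trans (≡.sym gw≡fw) (trans (≡.sym gu≡gw) gv≡x)))
    ... | inj₂ (u∈S' , gu≡fu) | inj₁ (refl , gv≡x)  =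
      ⊥-elim (fresh u∈S' (trans (≡.sym gu≡fu) (trans gu≡gw gv≡x)))
    ... | inj₂ (u∈S' , gu≡fu) | inj₂ (w∈S' , gw≡fw) =
      injective-on u∈S' w∈S' (trans (≡.sym gu≡fu) (trans gu≡gw gw≡fw))

    preserves : ∀ {u w} → u ∈ S → w ∈ S → adj H u w ≡ true → adj G (g u) (g w) ≡ true
    preserves u∈S w∈S uw with new-or-old u∈S | new-or-old w∈S
    ... | inj₁ (refl , _)     | inj₁ (refl , _) with () ← trans (≡.sym uw) (irrefl H v)
    ... | inj₁ (refl , gv≡x)  | inj₂ (w∈S' , gw≡fw) =
      subst₂ (λ a b → adj G a b ≡ true) (≡.sym gv≡x) (≡.sym gw≡fw)
        (trans (sym G x _) (adjacent w∈S' uw))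
    ... | inj₂ (u∈S' , gu≡fu) | inj₁ (refl , gv≡x)  =
      subst₂ (λ a b → adj G a b ≡ true) (≡.sym gu≡fu) (≡.sym gv≡x)
        (adjacent u∈S' (trans (sym H v _) uw))
    ... | inj₂ (u∈S' , gu≡fu) | inj₂ (w∈S' , gw≡fw) =
      subst₂ (λ a b → adj G a b ≡ true) (≡.sym gu≡fu) (≡.sym gw≡fw) (preserves-edges u∈S' w∈S' uw)

module Greedy {d q : ℕ} (H G : Graph) (degenerate : Degenerate d H)
  {c : Fin (size H) → Fin q} (proper : ProperColouring H q c)
  (Y : Fin q → Subset (size G)) {m : ℕ} (∣Y∣≡m : ∀ i → ∣ Y i ∣ ≡ m) (4n≤m : 4 * size H ≤ m)
  (few-non-nbrs : ∀ i v → v ∈ Y i → nonNbrsOutside G Y i v * (2 * d) ≤ ∣ Y i ∣) where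

  open Embedding H G c Y

  private
    V = Fin (size H)
    W = Fin (size G)

  missed : V → (V → W) → V → Subset (size G)
  missed v f u = Y (c v) ∩ ∁ (N[ G ] (f u))

  forbidden : Subset (size H) → V → (V → W) → Subset (size G)
  forbidden S v f = ⋃[ S - v ] (⁅_⁆ ∘ f) ∪ ⋃[ (S - v) ∩ N[ H ] v ] (missed v f)

  ∑∣missed∣*2≤m : ∀ {S v f} → degIn H S v ≤ d → EmbeddingOn (S - v) f →
                  ∑[ (S - v) ∩ N[ H ] v ] (∣_∣ ∘ missed v f) * 2 ≤ m
  ∑∣missed∣*2≤m {S} {v} {f} deg-v emb = begin
    ∑[ A ] (∣_∣ ∘ missed v f) * 2         ≡⟨ ∑-*ʳ A (∣_∣ ∘ missed v f) 2 ⟨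
    ∑[ A ] (λ u → ∣ missed v f u ∣ * 2)   ≤⟨ ∑-average A ∣A∣≤d each ⟩
    m                                     ∎
    where
    open ≤-Reasoning
    open EmbeddingOn emb
    A = (S - v) ∩ N[ H ] v

    ∣A∣≤d : ∣ A ∣ ≤ d
    ∣A∣≤d = ≤-trans (p⊆q⇒∣p∣≤∣q∣ (∩-monoˡ-⊆ (N[ H ] v) (p─q⊆p S ⁅ v ⁆))) deg-v

    each : ∀ {u} → u ∈ A → ∣ missed v f u ∣ * 2 * d ≤ m
    each {u} u∈A with x∈p∩q⁻ (S - v) (N[ H ] v) u∈A
    ... | u∈S-v , u∈Nv = begin
      ∣ missed v f u ∣ * 2 * d                    ≡⟨ *-assoc ∣ missed v f u ∣ 2 d ⟩
      ∣ missed v f u ∣ * (2 * d)                  ≤⟨ *-monoˡ-≤ (2 * d) (p⊆q⇒∣p∣≤∣q∣ missed⊆) ⟩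
      nonNbrsOutside G Y (c u) (f u) * (2 * d)    ≤⟨ few-non-nbrs (c u) (f u) (respects-parts u∈S-v) ⟩
      ∣ Y (c u) ∣                                 ≡⟨ ∣Y∣≡m (c u) ⟩
      m                                           ∎
      where
      missed⊆ : missed v f u ⊆ OtherParts Y (c u) ∩ ∁ (N[ G ] (f u))
      missed⊆ = ∩-monoˡ-⊆ _ (Y⊆OtherParts Y (proper v u (∈N[]⁻ H u∈Nv)))

  ∣forbidden∣<m : ∀ {S v f} → v ∈ S → degIn H S v ≤ d → EmbeddingOn (S - v) f →
                  ∣ forbidden S v f ∣ < m
  ∣forbidden∣<m {S} {v} {f} v∈S deg-v emb = begin-strict
    ∣ forbidden S v f ∣
      ≤⟨ ∣p∪q∣≤∣p∣+∣q∣ (⋃[ S - v ] (⁅_⁆ ∘ f)) _ ⟩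
    ∣ ⋃[ S - v ] (⁅_⁆ ∘ f) ∣ + ∣ ⋃[ (S - v) ∩ N[ H ] v ] (missed v f) ∣
      ≤⟨ +-mono-≤ (∣image∣≤∣p∣ (S - v) f) (∣⋃[]∣≤∑ ((S - v) ∩ N[ H ] v) (missed v f)) ⟩
    ∣ S - v ∣ + ∑[ (S - v) ∩ N[ H ] v ] (∣_∣ ∘ missed v f)
      <⟨ 4[1+s]≤m∧t*2≤m⇒s+t<m 4[1+∣S-v∣]≤m (∑∣missed∣*2≤m deg-v emb) ⟩
    m ∎
    where
    open ≤-Reasoning
    4[1+∣S-v∣]≤m : 4 * suc ∣ S - v ∣ ≤ m
    4[1+∣S-v∣]≤m = ≤-trans (*-monoʳ-≤ 4 (≤-trans (x∈p⇒∣p-x∣<∣p∣ v∈S) (∣p∣≤n S))) 4n≤m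

  free-vertex : ∀ {S v f} → v ∈ S → degIn H S v ≤ d → EmbeddingOn (S - v) f →
                ∃ λ x → x ∈ Y (c v) × x ∉ forbidden S v f
  free-vertex {S} {v} {f} v∈S deg-v emb =
    ∣q∣<∣p∣⇒∃∈p∖q (Y (c v)) (forbidden S v f)
      (subst (∣ forbidden S v f ∣ <_) (≡.sym (∣Y∣≡m (c v))) (∣forbidden∣<m v∈S deg-v emb))

  place : ∀ {S v f x} → EmbeddingOn (S - v) f → x ∈ Y (c v) → x ∉ forbidden S v f →
          EmbeddingOn S (updateAt f v (const x))
  place {S} {v} {f} {x} emb x∈Y x∉F = extend emb x∈Y fresh adjacent
    where
    fresh : ∀ {u} → u ∈ S - v → f u ≢ x
    fresh u∈S-v refl = x∉F (p⊆p∪q _ (∈image (S - v) f u∈S-v))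

    adjacent : ∀ {u} → u ∈ S - v → adj H v u ≡ true → adj G (f u) x ≡ true
    adjacent u∈S-v vu = ∈N[]⁻ G (x∉∁p⇒x∈p λ x∈∁N → x∉F (q⊆p∪q _ _
      (⊆⋃[] ((S - v) ∩ N[ H ] v) (missed v f) (x∈p∩q⁺ (u∈S-v , ∈N[]⁺ H vu)) (x∈p∩q⁺ (x∈Y , x∈∁N)))))

  n≤∣G∣ : Fin q → size H ≤ size G
  n≤∣G∣ i = begin
    size H        ≤⟨ m≤n*m (size H) 4 ⟩
    4 * size H    ≤⟨ 4n≤m ⟩
    m             ≡⟨ ∣Y∣≡m i ⟨
    ∣ Y i ∣       ≤⟨ ∣p∣≤n (Y i) ⟩
    size G        ∎
    where open ≤-Reasoning

  embeddingOn : ∀ k (S : Subset (size H)) → ∣ S ∣ ≤ k → ∃ (EmbeddingOn S)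
  embeddingOn k S _ with nonempty? S
  ... | no empty = (λ u → inject≤ u (n≤∣G∣ (c u))) , embeddingOn-empty empty _
  embeddingOn zero S ∣S∣≤0 | yes (u , u∈S) with () ← ≤-trans (x∈p⇒∣p-x∣<∣p∣ u∈S) ∣S∣≤0
  embeddingOn (suc k) S ∣S∣≤1+k | yes nonempty with degenerate S nonempty
  ... | v , v∈S , deg-v with embeddingOn k (S - v) (≤-pred (≤-trans (x∈p⇒∣p-x∣<∣p∣ v∈S) ∣S∣≤1+k))
  ... | f , emb with free-vertex v∈S deg-v emb
  ... | x , x∈Y , x∉F = updateAt f v (const x) , place emb x∈Y x∉F

lemma3p5 : (d q : ℕ) (H G : Graph) → Degenerate d H → ChromaticNumber H q →
    (Y : Fin q → Subset (size G)) →
    (∀ i j → i ≢ j → Empty (Y i ∩ Y j)) →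
    (m : ℕ) → (∀ i → ∣ Y i ∣ ≡ m) → 4 * size H ≤ m →
    (∀ i v → v ∈ Y i → nonNbrsOutside G Y i v * (2 * d) ≤ ∣ Y i ∣) →
    IsSubgraph H G
lemma3p5 d q H G degenerate ((c , proper) , _) Y _ m ∣Y∣≡m 4n≤m few-non-nbrs
  with Greedy.embeddingOn H G degenerate proper Y ∣Y∣≡m 4n≤m few-non-nbrs (size H) ⊤ (∣p∣≤n ⊤)
... | f , emb = f , injective-on ∈⊤ ∈⊤ , λ _ _ → preserves-edges ∈⊤ ∈⊤
  where open Embedding.EmbeddingOn emb
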